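{- (a) $(P_3\times P_2)^{(2)}\in\mathscr{C}_1$. (b) Let $\lambda\ge\mu\ge 2$ and $n=\lambda\mu$. If $\lambda\ge 4$ and $\mu=2$, or if $\lambda\ge\mu\ge 3$, then $(P_\lambda\times P_\mu)(s_1,\dots,s_n)\in\mathscr{C}_0$ for all integers $s_1,\dots,s_n\ge 2$. If $(\lambda,\mu)=(3,2)$, then $(P_\lambda\times P_\mu)(s_1,\dots,s_n)\in\mathscr{C}_0\cup\mathscr{C}_1$ for all integers $s_1,\dots,s_n\ge 2$.
   Context: $P_k$ denotes the path on $k$ vertices; $d(\cdot)$ denotes diameter. For a graph $G$ with vertex set $\{v_1,\dots,v_n\}$ and positive integers $s_1,\dots,s_n$, the vertex-multiplication $G(s_1,\dots,s_n)$ is the graph whose vertex set is a disjoint union $V_1\cup\dots\cup V_n$ with $|V_i|=s_i$, where $u\in V_i$ and $v\in V_j$ are adjacent iff $i\ne j$ and $v_iv_j\in E(G)$; $G^{(s)}=G(s,\dots,s)$. For a connected bridgeless graph $X$, $\bar d(X)$ is the minimum diameter of a strong orientation of $X$. For $j\in\{0,1,2\}$, $\mathscr{C}_j$ is the class of all vertex-multiplications $G(s_1,\dots,s_n)$ of a connected graph $G$ with all $s_i\ge 2$ such that $\bar d(G(s_1,\dots,s_n))=d(G)+j$. The cartesian product $G\times H$ has vertex set $\{\langle u,x\rangle\}$, with $\langle u,x\rangle\langle v,y\rangle$ an edge iff either $u=v$ and $xy\in E(H)$, or $uv\in E(G)$ and $x=y$. -}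

module Defs where

open import Level using (0ℓ)
open import Data.Nat using (ℕ; zero; suc; _+_; _≤_)
open import Data.Fin using (Fin; toℕ)
open import Data.Product using (Σ; _×_; _,_)
open import Data.Sum using (_⊎_)
open import Relation.Binary.PropositionalEquality using (_≡_)
open import Relation.Nullary using (¬_)

record Graph : Set₁ where
  field
    V : Set
    E : V → V → Set
open Graph public

-- Reach R k u v : there is a directed R-walk from u to v of length ≤ k,
-- i.e. dist_R(u,v) ≤ k.
data Reach {V : Set} (R : V → V → Set) : ℕ → V → V → Set where
  here : ∀ {k u} → Reach R k u u
  step : ∀ {k u w v} → R u w → Reach R k w v → Reach R (suc k) u v

HasDiam : {V : Set} → (V → V → Set) → ℕ → Set
HasDiam {V} R d =
  ((u v : V) → Reach R d u v) ×
  ((d' : ℕ) → ((u v : V) → Reach R d' u v) → d ≤ d')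

IsOrientation : {V : Set} → (V → V → Set) → (V → V → Set) → Set
IsOrientation {V} E D =
  ((u v : V) → D u v → E u v) ×
  ((u v : V) → E u v → D u v ⊎ D v u) ×
  ((u v : V) → ¬ (D u v × D v u))

-- d̄(X) = d : minimum diameter of a strong orientation of X is d.
-- (An orientation is strong iff it has a finite diameter.)
MinOrientDiam : Graph → ℕ → Set₁
MinOrientDiam X d =
  (Σ (V X → V X → Set) λ D → IsOrientation (E X) D × HasDiam D d) ×
  ((D : V X → V X → Set) (d' : ℕ) →
     IsOrientation (E X) D → HasDiam D d' → d ≤ d')

Path : ℕ → Graph
Path k = record
  { V = Fin k
  ; E = λ i j → (suc (toℕ i) ≡ toℕ j) ⊎ (suc (toℕ j) ≡ toℕ i)
  }

_□_ : Graph → Graph → Graph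
G □ H = record
  { V = V G × V H
  ; E = λ { (u , x) (v , y) → (u ≡ v × E H x y) ⊎ (E G u v × x ≡ y) }
  }

VMult : (G : Graph) → (V G → ℕ) → Graph
VMult G s = record
  { V = Σ (V G) (λ i → Fin (s i))
  ; E = λ { (i , a) (j , b) → ¬ (i ≡ j) × E G i j }
  }

InC : ℕ → (G : Graph) → (V G → ℕ) → Set₁
InC j G s =
  ((i : V G) → 2 ≤ s i) ×
  Σ ℕ (λ dG → HasDiam (E G) dG × MinOrientDiam (VMult G s) (dG + j))

-- Projecting walks to the grid bounds the diameter of every orientation of G(s) below by d(G).
-- For the upper bound the copies of a vertex get a type (the first copy false, the others true)
-- and a design orients each edge between copies from the positions and types of its ends. Walks
-- in the finite graph of (position, type) states lift to walks between any two copies, so it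
-- suffices to join all pairs of states within the target length. The parity design does so on
-- P_λ × P_μ within d(G) for λ ≥ μ ≥ 3, by staircase walks whose final type is chosen at the
-- last unit square, and on P₃ × P₂ within 4. On P_λ × P₂ it is rewired at column 1; the 4 × 2
-- window is checked by computation and the rest is again staircases. Whether (P₃ × P₂)(s) has
-- an orientation of diameter 3 is decidable by exhaustive search (if not, the parity design is
-- optimal), and for s ≡ 2 a search-tree certificate shows that it has none.

module Submission where

open import Data.Bool using (Bool; true; false; not; _xor_; _∧_; if_then_else_; T)
open import Data.Bool.Properties
  using (not-involutive; xor-same; xor-comm; xor-assoc; xor-identityʳ; T-∧) renaming (_≟_ to _≟ᵇ_)
open import Data.Empty using (⊥; ⊥-elim)
open import Data.Fin using (Fin; zero; suc; toℕ; fromℕ; fromℕ<; #_)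
open import Data.Fin.Properties
  using (toℕ-injective; toℕ<n; toℕ-fromℕ; toℕ-fromℕ<; toℕ≤pred[n]; any?; all?) renaming (_≟_ to _≟ᶠ_)
open import Data.Maybe using (Maybe; just; nothing; maybe′)
open import Data.Maybe.Relation.Unary.All using (just; nothing) renaming (All to AllMaybe)
open import Data.Nat using (ℕ; zero; suc; _+_; _∸_; _⊔_; _≤_; _<_; z≤n; s≤s; _<?_; _≡ᵇ_; _<ᵇ_)
open import Data.Nat.Properties
open import Data.Product using (Σ; ∃; _×_; _,_; proj₁; proj₂)
open import Data.Product.Properties using (≡-dec)
open import Data.Sum using (_⊎_; inj₁; inj₂; [_,_]′)
open import Data.Unit using (⊤; tt)
open import Data.Vec using (Vec; _∷_; []; lookup)
open import Function using (_∘_)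
open import Function.Bundles using (Equivalence)
open import Relation.Binary using (DecidableEquality; Symmetric; tri<; tri≈; tri>)
open import Relation.Binary.PropositionalEquality
  using (_≡_; _≢_; refl; sym; trans; cong; cong₂; subst; subst₂)
open import Relation.Nullary using (Dec; yes; no; ¬_)
open import Relation.Nullary.Decidable
  using (_×-dec_; _⊎-dec_; _→-dec_; map′; ¬?; decidable-stable; from-yes; isNo; toWitnessFalse)
open import Relation.Unary using (Decidable)

open import Defs

module _ {V : Set} {R : V → V → Set} where

  reach-mono : ∀ {k k′ u v} → k ≤ k′ → Reach R k u v → Reach R k′ u v
  reach-mono _          here       = here
  reach-mono (s≤s k≤k′) (step r p) = step r (reach-mono k≤k′ p)

  reach-++ : ∀ {a b u w v} → Reach R a u w → Reach R b w v → Reach R (a + b) u v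
  reach-++ {a} {b} here q = reach-mono (m≤n+m b a) q
  reach-++ (step r p) q   = step r (reach-++ p q)

  reach-snoc : ∀ {k u w v} → Reach R k u w → R w v → Reach R (suc k) u v
  reach-snoc here       r′ = step r′ here
  reach-snoc (step r p) r′ = step r (reach-snoc p r′)

  reach-sym : Symmetric R → ∀ {k u v} → Reach R k u v → Reach R k v u
  reach-sym R-sym here       = here
  reach-sym R-sym (step r p) = reach-snoc (reach-sym R-sym p) (R-sym r)

  reach-potential : (φ : V → ℕ) → (∀ {u v} → R u v → φ v ≤ suc (φ u)) →
                    ∀ {k u v} → Reach R k u v → φ v ≤ k + φ u
  reach-potential φ φ-step {k} {u} here = m≤n+m (φ u) k
  reach-potential φ φ-step {suc k} {u} {v} (step {w = w} r p) = begin
    φ v           ≤⟨ reach-potential φ φ-step p ⟩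
    k + φ w       ≤⟨ +-monoʳ-≤ k (φ-step r) ⟩
    k + suc (φ u) ≡⟨ +-suc k (φ u) ⟩
    suc k + φ u   ∎
    where open ≤-Reasoning

reach-map : {V W : Set} {R : V → V → Set} {S : W → W → Set} (f : V → W) →
            (∀ {u v} → R u v → S (f u) (f v)) → ∀ {k u v} → Reach R k u v → Reach S k (f u) (f v)
reach-map f f-arc here       = here
reach-map f f-arc (step r p) = step (f-arc r) (reach-map f f-arc p)

DiamAtMost : {V : Set} → (V → V → Set) → ℕ → Set
DiamAtMost {V} R d = (u v : V) → Reach R d u v

data Reach⁺ {V : Set} (R : V → V → Set) : ℕ → V → V → Set where
  step⁺ : ∀ {k u w v} → R u w → Reach R k w v → Reach⁺ R (suc k) u v

module _ {V : Set} {R : V → V → Set} where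

  reach⁺⇒reach : ∀ {k u v} → Reach⁺ R k u v → Reach R k u v
  reach⁺⇒reach (step⁺ r p) = step r p

  reach⁺-mono : ∀ {k k′ u v} → k ≤ k′ → Reach⁺ R k u v → Reach⁺ R k′ u v
  reach⁺-mono (s≤s k≤k′) (step⁺ r p) = step⁺ r (reach-mono k≤k′ p)

  reach⁺-cons : ∀ {k u w v} → R u w → Reach⁺ R k w v → Reach⁺ R (suc k) u v
  reach⁺-cons r p = step⁺ r (reach⁺⇒reach p)

  reach⁺-snoc : ∀ {k u w v} → Reach⁺ R k u w → R w v → Reach⁺ R (suc k) u v
  reach⁺-snoc (step⁺ r p) r′ = step⁺ r (reach-snoc p r′)

  reach⁺-++ : ∀ {a b u w v} → Reach⁺ R a u w → Reach R b w v → Reach⁺ R (a + b) u v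
  reach⁺-++ (step⁺ r p) q = step⁺ r (reach-++ p q)

  reach-++⁺ : ∀ {a b u w v} → Reach R a u w → Reach⁺ R b w v → Reach⁺ R (a + b) u v
  reach-++⁺ {a} {b} here q = reach⁺-mono (m≤n+m b a) q
  reach-++⁺ (step r p) q   = step⁺ r (reach-++ p (reach⁺⇒reach q))

reach⁺-map : {V W : Set} {R : V → V → Set} {S : W → W → Set} (f : V → W) →
             (∀ {u v} → R u v → S (f u) (f v)) → ∀ {k u v} → Reach⁺ R k u v → Reach⁺ S k (f u) (f v)
reach⁺-map f f-arc (step⁺ r p) = step⁺ (f-arc r) (reach-map f f-arc p)

Searchable : Set → Set₁
Searchable A = ∀ {P : A → Set} → Decidable P → Dec (∃ P)

searchable-Fin : ∀ n → Searchable (Fin n)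
searchable-Fin n = any?

searchable-Bool : Searchable Bool
searchable-Bool P? = map′ (λ { (inj₁ p) → false , p ; (inj₂ p) → true , p })
                          (λ { (false , p) → inj₁ p ; (true , p) → inj₂ p })
                          (P? false ⊎-dec P? true)

searchable-Σ : {A : Set} {B : A → Set} → Searchable A → (∀ a → Searchable (B a)) → Searchable (Σ A B)
searchable-Σ search-A search-B P? =
  map′ (λ (a , b , p) → (a , b) , p) (λ ((a , b) , p) → a , b , p)
       (search-A (λ a → search-B a (λ b → P? (a , b))))

searchable-× : {A B : Set} → Searchable A → Searchable B → Searchable (A × B)
searchable-× search-A search-B = searchable-Σ search-A (λ _ → search-B)

searchable-∀ : {A : Set} {P : A → Set} → Searchable A → Decidable P → Dec ((a : A) → P a)
searchable-∀ search P? =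
  map′ (λ ∄¬P a → decidable-stable (P? a) (λ ¬p → ∄¬P (a , ¬p)))
       (λ ∀P (a , ¬p) → ¬p (∀P a))
       (¬? (search (λ a → ¬? (P? a))))

module _ {V : Set} {R : V → V → Set} (search : Searchable V) (_≟_ : DecidableEquality V)
         (R? : ∀ u v → Dec (R u v)) where

  reach? : ∀ k u v → Dec (Reach R k u v)
  reach⁺? : ∀ k u v → Dec (Reach⁺ R k u v)

  reach? k u v with u ≟ v
  ... | yes refl = yes here
  ... | no u≢v   = map′ reach⁺⇒reach (λ { here → ⊥-elim (u≢v refl) ; (step r p) → step⁺ r p })
                        (reach⁺? k u v)

  reach⁺? zero    u v = no λ ()
  reach⁺? (suc k) u v = map′ (λ (w , r , p) → step⁺ r p) (λ { (step⁺ r p) → _ , r , p })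
                             (search (λ w → R? u w ×-dec reach? k w v))

Pos : Set
Pos = ℕ × ℕ

Adjℕ : ℕ → ℕ → Set
Adjℕ i j = suc i ≡ j ⊎ suc j ≡ i

Adj : Pos → Pos → Set
Adj (a , b) (a′ , b′) = (a ≡ a′ × Adjℕ b b′) ⊎ (Adjℕ a a′ × b ≡ b′)

adj? : ∀ x y → Dec (Adj x y)
adj? (a , b) (a′ , b′) = ((a ≟ a′) ×-dec adjℕ? b b′) ⊎-dec (adjℕ? a a′ ×-dec (b ≟ b′))
  where adjℕ? : ∀ i j → Dec (Adjℕ i j)
        adjℕ? i j = (suc i ≟ j) ⊎-dec (suc j ≟ i)

adjℕ-sym : ∀ {i j} → Adjℕ i j → Adjℕ j i
adjℕ-sym (inj₁ e) = inj₂ e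
adjℕ-sym (inj₂ e) = inj₁ e

adj-sym : ∀ {x y} → Adj x y → Adj y x
adj-sym (inj₁ (a≡a′ , e)) = inj₁ (sym a≡a′ , adjℕ-sym e)
adj-sym (inj₂ (e , b≡b′)) = inj₂ (adjℕ-sym e , sym b≡b′)

adjℕ-irrefl : ∀ {i} → ¬ Adjℕ i i
adjℕ-irrefl (inj₁ e) = 1+n≢n e
adjℕ-irrefl (inj₂ e) = 1+n≢n e

adj-irrefl : ∀ {x} → ¬ Adj x x
adj-irrefl (inj₁ (_ , e)) = adjℕ-irrefl e
adj-irrefl (inj₂ (e , _)) = adjℕ-irrefl e

Grid : ℕ → ℕ → Graph
Grid l m = Path l □ Path m

pos : ∀ {l m} → V (Grid l m) → Pos
pos (i , j) = toℕ i , toℕ j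

module _ {l m : ℕ} where

  grid⇒adj : ∀ {x y : V (Grid l m)} → E (Grid l m) x y → Adj (pos x) (pos y)
  grid⇒adj (inj₁ (i≡i′ , e)) = inj₁ (cong toℕ i≡i′ , e)
  grid⇒adj (inj₂ (e , j≡j′)) = inj₂ (e , cong toℕ j≡j′)

  adj⇒grid : ∀ {x y : V (Grid l m)} → Adj (pos x) (pos y) → E (Grid l m) x y
  adj⇒grid (inj₁ (i≡i′ , e)) = inj₁ (toℕ-injective i≡i′ , e)
  adj⇒grid (inj₂ (e , j≡j′)) = inj₂ (e , toℕ-injective j≡j′)

  grid-sym : Symmetric (E (Grid l m))
  grid-sym = adj⇒grid ∘ adj-sym ∘ grid⇒adj

  grid-irrefl : ∀ {x} → ¬ E (Grid l m) x x
  grid-irrefl = adj-irrefl ∘ grid⇒adj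

  grid? : ∀ x y → Dec (E (Grid l m) x y)
  grid? x y = map′ adj⇒grid grid⇒adj (adj? (pos x) (pos y))

path-walk : ∀ {n} k (i j : Fin n) → toℕ i + k ≡ toℕ j → Reach (E (Path n)) k i j
path-walk zero i j i+0≡j =
  subst (Reach _ 0 i) (toℕ-injective (trans (sym (+-identityʳ (toℕ i))) i+0≡j)) here
path-walk {n} (suc k) i j i+k+1≡j = step (inj₁ (sym (toℕ-fromℕ< i+1<n))) (path-walk k i′ j i′+k≡j)
  where
    i+1<n : suc (toℕ i) < n
    i+1<n = ≤-<-trans (≤-trans (m≤m+n (suc (toℕ i)) k) (≤-reflexive (trans (sym (+-suc (toℕ i) k)) i+k+1≡j)))
                      (toℕ<n j)
    i′ = fromℕ< i+1<n
    i′+k≡j : toℕ i′ + k ≡ toℕ j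
    i′+k≡j = trans (cong (_+ k) (toℕ-fromℕ< i+1<n)) (trans (sym (+-suc (toℕ i) k)) i+k+1≡j)

path-reach : ∀ {n} (i j : Fin (suc n)) → Reach (E (Path (suc n))) n i j
path-reach {n} i j with ≤-total (toℕ i) (toℕ j)
... | inj₁ i≤j = reach-mono (≤-trans (m∸n≤m (toℕ j) (toℕ i)) (toℕ≤pred[n] j))
                   (path-walk (toℕ j ∸ toℕ i) i j (m+[n∸m]≡n i≤j))
... | inj₂ j≤i = reach-mono (≤-trans (m∸n≤m (toℕ i) (toℕ j)) (toℕ≤pred[n] i))
                   (reach-sym adjℕ-sym (path-walk (toℕ i ∸ toℕ j) j i (m+[n∸m]≡n j≤i)))

grid-reach : ∀ {l m} (x y : V (Grid (suc l) (suc m))) → Reach (E (Grid (suc l) (suc m))) (l + m) x y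
grid-reach (i , j) (i′ , j′) =
  reach-++ (reach-map (_, j) (λ e → inj₂ (e , refl)) (path-reach i i′))
           (reach-map (i′ ,_) (λ e → inj₁ (refl , e)) (path-reach j j′))

corner-distance : ∀ {l m k} → Reach (E (Grid (suc l) (suc m))) k (zero , zero) (fromℕ l , fromℕ m) → l + m ≤ k
corner-distance {l} {m} {k} p =
  subst₂ _≤_ (cong₂ _+_ (toℕ-fromℕ l) (toℕ-fromℕ m)) (+-identityʳ k) (reach-potential φ φ-step p)
  where
    φ : V (Grid (suc l) (suc m)) → ℕ
    φ (i , j) = toℕ i + toℕ j
    adjℕ-step : ∀ {a b} → Adjℕ a b → b ≤ suc a
    adjℕ-step (inj₁ refl) = ≤-refl
    adjℕ-step (inj₂ refl) = ≤-trans (n≤1+n _) (n≤1+n _)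
    φ-step : ∀ {x y} → E (Grid (suc l) (suc m)) x y → φ y ≤ suc (φ x)
    φ-step {i , j} (inj₁ (refl , e)) =
      ≤-trans (+-monoʳ-≤ (toℕ i) (adjℕ-step e)) (≤-reflexive (+-suc (toℕ i) (toℕ j)))
    φ-step {i , j} (inj₂ (e , refl)) = +-monoˡ-≤ (toℕ j) (adjℕ-step e)

grid-hasDiam : ∀ {l m} → HasDiam (E (Grid (suc l) (suc m))) (l + m)
grid-hasDiam = grid-reach , λ _ diam → corner-distance (diam _ _)

type : ∀ {n} → Fin n → Bool
type zero    = false
type (suc _) = true

pick : ∀ {n} → 2 ≤ n → Bool → Fin n
pick (s≤s (s≤s _)) false = zero
pick (s≤s (s≤s _)) true  = suc zero

type-pick : ∀ {n} (2≤n : 2 ≤ n) t → type (pick 2≤n t) ≡ t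
type-pick (s≤s (s≤s _)) false = refl
type-pick (s≤s (s≤s _)) true  = refl

vmult-sym : ∀ {G s} → Symmetric (E G) → ∀ u v → E (VMult G s) u v → E (VMult G s) v u
vmult-sym G-sym _ _ (i≢j , e) = (λ j≡i → i≢j (sym j≡i)) , G-sym e

Chosen : {V : Set} → (V → V → Set) → (V → V → Bool) → V → V → Set
Chosen E c u v = E u v × c u v ≡ true

chosen-isOrientation : {V : Set} {E : V → V → Set} → (∀ u v → E u v → E v u) → (c : V → V → Bool) →
                       (∀ {u v} → E u v → c v u ≡ not (c u v)) → IsOrientation E (Chosen E c)
chosen-isOrientation {E = E} E-sym c c-anti = (λ _ _ → proj₁) , total , asym
  where
    total : ∀ u v → E u v → Chosen E c u v ⊎ Chosen E c v u
    total u v e with c u v in c≡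
    ... | true  = inj₁ (e , refl)
    ... | false = inj₂ (E-sym u v e , trans (c-anti e) (cong not c≡))
    asym : ∀ u v → ¬ (Chosen E c u v × Chosen E c v u)
    asym u v ((e , cuv) , (_ , cvu)) with trans (sym cvu) (trans (c-anti e) (cong not cuv))
    ... | ()

orientation-projects : ∀ {G s D k u v} → IsOrientation (E (VMult G s)) D →
                       Reach D k u v → Reach (E G) k (proj₁ u) (proj₁ v)
orientation-projects (D⊆E , _) = reach-map proj₁ (λ {u} {v} d → proj₂ (D⊆E u v d))

vmult-diam-lower : ∀ {l m s D d} → ((x : V (Grid (suc l) (suc m))) → 2 ≤ s x) →
                   IsOrientation (E (VMult (Grid (suc l) (suc m)) s)) D → DiamAtMost D d → l + m ≤ d
vmult-diam-lower hs o diam =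
  corner-distance (orientation-projects o (diam (_ , pick (hs _) false) (_ , pick (hs _) false)))

inC-intro : ∀ {j G s dG d} {D : V (VMult G s) → V (VMult G s) → Set} →
            ((x : V G) → 2 ≤ s x) → HasDiam (E G) dG → dG + j ≡ d →
            IsOrientation (E (VMult G s)) D → DiamAtMost D d →
            (∀ {D′ d′} → IsOrientation (E (VMult G s)) D′ → DiamAtMost D′ d′ → d ≤ d′) →
            InC j G s
inC-intro hs diam-G refl o diam lower =
  hs , _ , diam-G , (_ , o , diam , λ _ diam′ → lower o diam′) , λ _ _ o′ (diam′ , _) → lower o′ diam′

State : Set
State = Pos × Bool

-- δ x t y t′ says whether the edge between a copy of type t over x and a copy of type t′ over y
-- points towards y.
Design : Set
Design = Pos → Bool → Pos → Bool → Bool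

Antisymmetric : Design → Set
Antisymmetric δ = ∀ {x y} → Adj x y → ∀ t t′ → δ y t′ x t ≡ not (δ x t y t′)

InBox : ℕ → ℕ → Pos → Set
InBox l m (a , b) = a < l × b < m

Step : ℕ → ℕ → Design → State → State → Set
Step l m δ (x , t) (y , t′) = InBox l m x × InBox l m y × Adj x y × δ x t y t′ ≡ true

step? : ∀ l m δ σ σ′ → Dec (Step l m δ σ σ′)
step? l m δ (x , t) (y , t′) = inBox? x ×-dec inBox? y ×-dec adj? x y ×-dec (δ x t y t′ ≟ᵇ true)
  where inBox? : ∀ x → Dec (InBox l m x)
        inBox? (a , b) = (a <? l) ×-dec (b <? m)

step-widen : ∀ {l l′ m δ σ σ′} → l ≤ l′ → Step l m δ σ σ′ → Step l′ m δ σ σ′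
step-widen l≤l′ ((a<l , b<m) , (a′<l , b′<m) , st) =
  (≤-trans a<l l≤l′ , b<m) , (≤-trans a′<l l≤l′ , b′<m) , st

Cell : ℕ → ℕ → Set
Cell l m = V (Grid l m) × Bool

cellState : ∀ {l m} → Cell l m → State
cellState (x , t) = pos x , t

Spans : ℕ → ℕ → Design → ℕ → Set
Spans l m δ d = (c c′ : Cell l m) → Reach⁺ (Step l m δ) d (cellState c) (cellState c′)

module DesignOrientation {l m : ℕ} (s : V (Grid l m) → ℕ) (hs : (x : V (Grid l m)) → 2 ≤ s x)
                         (δ : Design) (δ-anti : Antisymmetric δ) where

  X = VMult (Grid l m) s

  cell : V X → Cell l m
  cell (x , p) = x , type p

  choice : V X → V X → Bool
  choice (x , p) (y , q) = δ (pos x) (type p) (pos y) (type q)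

  Arc : V X → V X → Set
  Arc = Chosen (E X) choice

  arc-isOrientation : IsOrientation (E X) Arc
  arc-isOrientation =
    chosen-isOrientation (vmult-sym {Grid l m} grid-sym) choice
      λ {(_ , p)} {(_ , q)} (_ , e) → δ-anti (grid⇒adj e) (type p) (type q)

  step⇒arc : ∀ {u v} → Step l m δ (cellState (cell u)) (cellState (cell v)) → Arc u v
  step⇒arc (_ , _ , adj , δ≡true) = ((λ { refl → adj-irrefl adj }) , adj⇒grid adj) , δ≡true

  vertexAt : ∀ {y} → InBox l m y → V (Grid l m)
  vertexAt (a<l , b<m) = fromℕ< a<l , fromℕ< b<m

  pos-vertexAt : ∀ {y} (y∈box : InBox l m y) → pos (vertexAt y∈box) ≡ y
  pos-vertexAt (a<l , b<m) = cong₂ _,_ (toℕ-fromℕ< a<l) (toℕ-fromℕ< b<m)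

  lift : ∀ {k σ σ′} → Reach⁺ (Step l m δ) k σ σ′ →
         ∀ u v → cellState (cell u) ≡ σ → cellState (cell v) ≡ σ′ → Reach Arc k u v
  lift (step⁺ st here) u v refl refl = step (step⇒arc st) here
  lift (step⁺ {w = y , t} st (step st′ p)) u v refl refl =
    step (step⇒arc (subst (Step l m δ _) (sym w-state) st)) (lift (step⁺ st′ p) w v w-state refl)
    where
      y∈box = proj₁ (proj₂ st)
      w : V X
      w = vertexAt y∈box , pick (hs _) t
      w-state : cellState (cell w) ≡ (y , t)
      w-state = cong₂ _,_ (pos-vertexAt y∈box) (type-pick (hs _) t)

  spans⇒diam : ∀ {d} → Spans l m δ d → DiamAtMost Arc d
  spans⇒diam spans u v = lift (spans (cell u) (cell v)) u v refl refl

design-inC0 : ∀ {l m} (s : V (Grid (suc l) (suc m)) → ℕ) → ((x : V (Grid (suc l) (suc m))) → 2 ≤ s x) →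
              (δ : Design) → Antisymmetric δ → Spans (suc l) (suc m) δ (l + m) → InC 0 (Grid (suc l) (suc m)) s
design-inC0 s hs δ δ-anti spans =
  inC-intro hs grid-hasDiam (+-identityʳ _) arc-isOrientation (spans⇒diam spans) (vmult-diam-lower hs)
  where open DesignOrientation s hs δ δ-anti

-- The parity design

odd : ℕ → Bool
odd zero    = false
odd (suc n) = not (odd n)

-- Arcs lead from a copy of type t to the neighbouring copies of type t xor parityFlip: a step
-- right keeps the type, a step left flips it, and a step down (up) flips it exactly in the odd
-- (even) columns.
parityFlip : Pos → Pos → Bool
parityFlip (a , b) (a′ , b′) = if a ≡ᵇ a′ then (if b <ᵇ b′ then odd a else not (odd a)) else a′ <ᵇ a

parity : Design
parity x t y t′ = not ((t xor parityFlip x y) xor t′)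

≡ᵇ-refl : ∀ n → (n ≡ᵇ n) ≡ true
≡ᵇ-refl zero    = refl
≡ᵇ-refl (suc n) = ≡ᵇ-refl n

≡ᵇ-suc : ∀ n → (n ≡ᵇ suc n) ≡ false
≡ᵇ-suc zero    = refl
≡ᵇ-suc (suc n) = ≡ᵇ-suc n

suc-≡ᵇ : ∀ n → (suc n ≡ᵇ n) ≡ false
suc-≡ᵇ zero    = refl
suc-≡ᵇ (suc n) = suc-≡ᵇ n

<ᵇ-suc : ∀ n → (n <ᵇ suc n) ≡ true
<ᵇ-suc zero    = refl
<ᵇ-suc (suc n) = <ᵇ-suc n

suc-<ᵇ : ∀ n → (suc n <ᵇ n) ≡ false
suc-<ᵇ zero    = refl
suc-<ᵇ (suc n) = suc-<ᵇ n

parityFlip-right : ∀ a b → parityFlip (a , b) (suc a , b) ≡ false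
parityFlip-right a b rewrite ≡ᵇ-suc a | suc-<ᵇ a = refl

parityFlip-left : ∀ a b → parityFlip (suc a , b) (a , b) ≡ true
parityFlip-left a b rewrite suc-≡ᵇ a | <ᵇ-suc a = refl

parityFlip-down : ∀ a b → parityFlip (a , b) (a , suc b) ≡ odd a
parityFlip-down a b rewrite ≡ᵇ-refl a | <ᵇ-suc b = refl

parityFlip-up : ∀ a b → parityFlip (a , suc b) (a , b) ≡ not (odd a)
parityFlip-up a b rewrite ≡ᵇ-refl a | suc-<ᵇ b = refl

parityFlip-anti : ∀ {x y} → Adj x y → parityFlip y x ≡ not (parityFlip x y)
parityFlip-anti {a , b} (inj₁ (refl , inj₁ refl)) rewrite parityFlip-down a b | parityFlip-up a b = refl
parityFlip-anti {a , suc b} (inj₁ (refl , inj₂ refl))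
  rewrite parityFlip-down a b | parityFlip-up a b = sym (not-involutive (odd a))
parityFlip-anti {a , b} (inj₂ (inj₁ refl , refl)) rewrite parityFlip-right a b | parityFlip-left a b = refl
parityFlip-anti {suc a , b} (inj₂ (inj₂ refl , refl)) rewrite parityFlip-right a b | parityFlip-left a b = refl

xnor-flip : ∀ t t′ f → not ((t′ xor not f) xor t) ≡ not (not ((t xor f) xor t′))
xnor-flip true  true  true  = refl
xnor-flip true  true  false = refl
xnor-flip true  false true  = refl
xnor-flip true  false false = refl
xnor-flip false true  true  = refl
xnor-flip false true  false = refl
xnor-flip false false true  = refl
xnor-flip false false false = refl

parity-anti : Antisymmetric parity
parity-anti {x} {y} adj t t′ rewrite parityFlip-anti adj = xnor-flip t t′ (parityFlip x y)

ParityStepsFrom : (State → State → Set) → ℕ → ℕ → ℕ → Set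
ParityStepsFrom R l m c = ∀ {x y} → Adj x y → c ≤ proj₁ x → c ≤ proj₁ y → InBox l m x → InBox l m y →
                          ∀ t → R (x , t) (y , t xor parityFlip x y)

parity-steps : ∀ l m → ParityStepsFrom (Step l m parity) l m 0
parity-steps l m {x} {y} adj _ _ x∈box y∈box t = x∈box , y∈box , adj , cong not (xor-same (t xor parityFlip x y))

xor-either : ∀ t o t′ → t′ ≡ t xor o ⊎ t′ ≡ t xor not o
xor-either true  true  true  = inj₂ refl
xor-either true  true  false = inj₁ refl
xor-either true  false true  = inj₁ refl
xor-either true  false false = inj₂ refl
xor-either false true  true  = inj₁ refl
xor-either false true  false = inj₂ refl
xor-either false false true  = inj₂ refl
xor-either false false false = inj₁ refl

xor-either′ : ∀ t o t′ → t′ ≡ not t xor o ⊎ t′ ≡ not (t xor not o)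
xor-either′ true  true  true  = inj₁ refl
xor-either′ true  true  false = inj₂ refl
xor-either′ true  false true  = inj₂ refl
xor-either′ true  false false = inj₁ refl
xor-either′ false true  true  = inj₂ refl
xor-either′ false true  false = inj₁ refl
xor-either′ false false true  = inj₁ refl
xor-either′ false false false = inj₂ refl

xor-cancelʳ : ∀ t o → (t xor o) xor o ≡ t
xor-cancelʳ t o = trans (xor-assoc t o o) (trans (cong (t xor_) (xor-same o)) (xor-identityʳ t))

data Offset (a : ℕ) : ℕ → Set where
  offset : ∀ k → Offset a (suc k + a)

<⇒offset : ∀ {a a′} → a < a′ → Offset a a′
<⇒offset {zero} {suc a′} _ = subst (Offset 0) (cong suc (+-identityʳ a′)) (offset a′)
<⇒offset {suc a} (s≤s a<a′) with <⇒offset a<a′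
... | offset k = subst (Offset (suc a)) (+-suc (suc k) a) (offset k)

module ParityRegion (R : State → State → Set) (l m c : ℕ) (steps : ParityStepsFrom R l m c) where

  step-right : ∀ {a b} → c ≤ a → suc a < l → b < m → ∀ t → R ((a , b) , t) ((suc a , b) , t)
  step-right {a} {b} c≤a a+1<l b<m t =
    subst (λ t′ → R ((a , b) , t) ((suc a , b) , t′))
          (trans (cong (t xor_) (parityFlip-right a b)) (xor-identityʳ t))
      (steps (inj₂ (inj₁ refl , refl)) c≤a (≤-trans c≤a (n≤1+n a))
             (<-trans (n<1+n a) a+1<l , b<m) (a+1<l , b<m) t)

  step-left : ∀ {a b} → c ≤ a → suc a < l → b < m → ∀ t → R ((suc a , b) , t) ((a , b) , not t)
  step-left {a} {b} c≤a a+1<l b<m t =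
    subst (λ t′ → R ((suc a , b) , t) ((a , b) , t′))
          (trans (cong (t xor_) (parityFlip-left a b)) (xor-comm t true))
      (steps (inj₂ (inj₂ refl , refl)) (≤-trans c≤a (n≤1+n a)) c≤a
             (a+1<l , b<m) (<-trans (n<1+n a) a+1<l , b<m) t)

  step-down : ∀ {a b} → c ≤ a → a < l → suc b < m → ∀ t → R ((a , b) , t) ((a , suc b) , t xor odd a)
  step-down {a} {b} c≤a a<l b+1<m t =
    subst (λ f → R ((a , b) , t) ((a , suc b) , t xor f)) (parityFlip-down a b)
      (steps (inj₁ (refl , inj₁ refl)) c≤a c≤a (a<l , <-trans (n<1+n b) b+1<m) (a<l , b+1<m) t)

  step-up : ∀ {a b} → c ≤ a → a < l → suc b < m → ∀ t → R ((a , suc b) , t) ((a , b) , t xor not (odd a))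
  step-up {a} {b} c≤a a<l b+1<m t =
    subst (λ f → R ((a , suc b) , t) ((a , b) , t xor f)) (parityFlip-up a b)
      (steps (inj₁ (refl , inj₂ refl)) c≤a c≤a (a<l , b+1<m) (a<l , <-trans (n<1+n b) b+1<m) t)

  private
    two : ∀ {σ σ₁ σ′} → R σ σ₁ → R σ₁ σ′ → Reach⁺ R 2 σ σ′
    two r r′ = step⁺ r (step r′ here)

    c≤suc : ∀ {a} → c ≤ a → c ≤ suc a
    c≤suc c≤a = ≤-trans c≤a (n≤1+n _)

    c≤+ : ∀ {a} k → c ≤ a → c ≤ k + a
    c≤+ {a} k c≤a = ≤-trans c≤a (m≤n+m a k)

    m+n<o⇒n<o : ∀ m {n o} → m + n < o → n < o
    m+n<o⇒n<o m {n} = ≤-<-trans (m≤n+m n m)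

  -- Around a unit square the two monotone routes arrive with opposite types, so both types
  -- of the far corner are reached in two steps.
  square-se : ∀ {a b} → c ≤ a → suc a < l → suc b < m → ∀ t t′ →
              Reach⁺ R 2 ((a , b) , t) ((suc a , suc b) , t′)
  square-se {a} c≤a a+1<l b+1<m t t′ with xor-either t (odd a) t′
  ... | inj₁ refl = two (step-down c≤a (<⇒≤ a+1<l) b+1<m t) (step-right c≤a a+1<l b+1<m _)
  ... | inj₂ refl = two (step-right c≤a a+1<l (<⇒≤ b+1<m) t) (step-down (c≤suc c≤a) a+1<l b+1<m t)

  square-ne : ∀ {a b} → c ≤ a → suc a < l → suc b < m → ∀ t t′ →
              Reach⁺ R 2 ((a , suc b) , t) ((suc a , b) , t′)
  square-ne {a} c≤a a+1<l b+1<m t t′ with xor-either t (not (odd a)) t′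
  ... | inj₁ refl = two (step-up c≤a (<⇒≤ a+1<l) b+1<m t) (step-right c≤a a+1<l (<⇒≤ b+1<m) _)
  ... | inj₂ refl = two (step-right c≤a a+1<l b+1<m t) (step-up (c≤suc c≤a) a+1<l b+1<m t)

  square-sw : ∀ {a b} → c ≤ a → suc a < l → suc b < m → ∀ t t′ →
              Reach⁺ R 2 ((suc a , b) , t) ((a , suc b) , t′)
  square-sw {a} c≤a a+1<l b+1<m t t′ with xor-either′ t (odd a) t′
  ... | inj₁ refl = two (step-left c≤a a+1<l (<⇒≤ b+1<m) t) (step-down c≤a (<⇒≤ a+1<l) b+1<m (not t))
  ... | inj₂ refl = two (step-down (c≤suc c≤a) a+1<l b+1<m t) (step-left c≤a a+1<l b+1<m _)

  square-nw : ∀ {a b} → c ≤ a → suc a < l → suc b < m → ∀ t t′ →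
              Reach⁺ R 2 ((suc a , suc b) , t) ((a , b) , t′)
  square-nw {a} c≤a a+1<l b+1<m t t′ with xor-either′ t (not (odd a)) t′
  ... | inj₁ refl = two (step-left c≤a a+1<l b+1<m t) (step-up c≤a (<⇒≤ a+1<l) b+1<m (not t))
  ... | inj₂ refl = two (step-up (c≤suc c≤a) a+1<l b+1<m t) (step-left c≤a a+1<l (<⇒≤ b+1<m) _)

  walk-se : ∀ P Q {a b} → c ≤ a → suc P + a < l → suc Q + b < m → ∀ t t′ →
            Reach⁺ R (suc P + suc Q) ((a , b) , t) ((suc P + a , suc Q + b) , t′)
  walk-se zero zero c≤a a+1<l b+1<m t t′ = square-se c≤a a+1<l b+1<m t t′
  walk-se zero (suc Q) {a} c≤a a+1<l b+Q+2<m t t′ =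
    reach⁺-snoc (walk-se zero Q c≤a a+1<l (<⇒≤ b+Q+2<m) t (t′ xor odd (suc a)))
      (subst (λ t″ → R ((suc a , suc Q + _) , t′ xor odd (suc a)) ((suc a , suc (suc Q + _)) , t″))
             (xor-cancelʳ t′ (odd (suc a))) (step-down (c≤suc c≤a) a+1<l b+Q+2<m _))
  walk-se (suc P) Q c≤a a+P+2<l b+Q+1<m t t′ =
    reach⁺-snoc (walk-se P Q c≤a (<⇒≤ a+P+2<l) b+Q+1<m t t′)
                (step-right (c≤+ (suc P) c≤a) a+P+2<l b+Q+1<m t′)

  walk-ne : ∀ P Q {a b} → c ≤ a → suc P + a < l → suc Q + b < m → ∀ t t′ →
            Reach⁺ R (suc P + suc Q) ((a , suc Q + b) , t) ((suc P + a , b) , t′)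
  walk-ne zero zero c≤a a+1<l b+1<m t t′ = square-ne c≤a a+1<l b+1<m t t′
  walk-ne zero (suc Q) c≤a a+1<l b+Q+2<m t t′ =
    reach⁺-cons (step-up c≤a (<⇒≤ a+1<l) b+Q+2<m t) (walk-ne zero Q c≤a a+1<l (<⇒≤ b+Q+2<m) _ t′)
  walk-ne (suc P) Q c≤a a+P+2<l b+Q+1<m t t′ =
    reach⁺-snoc (walk-ne P Q c≤a (<⇒≤ a+P+2<l) b+Q+1<m t t′)
                (step-right (c≤+ (suc P) c≤a) a+P+2<l (m+n<o⇒n<o (suc Q) b+Q+1<m) t′)

  walk-sw : ∀ P Q {a b} → c ≤ a → suc P + a < l → suc Q + b < m → ∀ t t′ →
            Reach⁺ R (suc P + suc Q) ((suc P + a , b) , t) ((a , suc Q + b) , t′)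
  walk-sw zero zero c≤a a+1<l b+1<m t t′ = square-sw c≤a a+1<l b+1<m t t′
  walk-sw zero (suc Q) {a} c≤a a+1<l b+Q+2<m t t′ =
    reach⁺-snoc (walk-sw zero Q c≤a a+1<l (<⇒≤ b+Q+2<m) t (t′ xor odd a))
      (subst (λ t″ → R ((a , suc Q + _) , t′ xor odd a) ((a , suc (suc Q + _)) , t″))
             (xor-cancelʳ t′ (odd a)) (step-down c≤a (<⇒≤ a+1<l) b+Q+2<m _))
  walk-sw (suc P) Q c≤a a+P+2<l b+Q+1<m t t′ =
    reach⁺-cons (step-left (c≤+ (suc P) c≤a) a+P+2<l (m+n<o⇒n<o (suc Q) b+Q+1<m) t)
                (walk-sw P Q c≤a (<⇒≤ a+P+2<l) b+Q+1<m _ t′)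

  walk-nw : ∀ P Q {a b} → c ≤ a → suc P + a < l → suc Q + b < m → ∀ t t′ →
            Reach⁺ R (suc P + suc Q) ((suc P + a , suc Q + b) , t) ((a , b) , t′)
  walk-nw zero zero c≤a a+1<l b+1<m t t′ = square-nw c≤a a+1<l b+1<m t t′
  walk-nw zero (suc Q) c≤a a+1<l b+Q+2<m t t′ =
    reach⁺-cons (step-up (c≤suc c≤a) a+1<l b+Q+2<m t) (walk-nw zero Q c≤a a+1<l (<⇒≤ b+Q+2<m) _ t′)
  walk-nw (suc P) Q c≤a a+P+2<l b+Q+1<m t t′ =
    reach⁺-cons (step-left (c≤+ (suc P) c≤a) a+P+2<l b+Q+1<m t) (walk-nw P Q c≤a (<⇒≤ a+P+2<l) b+Q+1<m _ t′)

  row-right : ∀ k {a b} → c ≤ a → k + a < l → b < m → ∀ t → Reach R k ((a , b) , t) ((k + a , b) , t)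
  row-right zero    c≤a a<l b<m t = here
  row-right (suc k) c≤a a+k+1<l b<m t =
    reach-snoc (row-right k c≤a (<⇒≤ a+k+1<l) b<m t) (step-right (c≤+ k c≤a) a+k+1<l b<m t)

  row-left : ∀ k {a b} → c ≤ a → k + a < l → b < m → ∀ t →
             ∃ λ t′ → Reach R k ((k + a , b) , t) ((a , b) , t′)
  row-left zero    c≤a a<l b<m t = t , here
  row-left (suc k) c≤a a+k+1<l b<m t with row-left k c≤a (<⇒≤ a+k+1<l) b<m (not t)
  ... | t′ , p = t′ , step (step-left (c≤+ k c≤a) a+k+1<l b<m t) p

  -- A zero displacement in a coordinate costs a detour of two steps, hence the `⊔ 2`.
  module Spanning {d : ℕ} (two-columns : suc c < l) (two-rows : 1 < m)
                  (budget : ∀ P Q → c + P < l → Q < m → (P ⊔ 2) + (Q ⊔ 2) ≤ d) where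

    private
      c<l : c + 0 < l
      c<l = subst (_< l) (sym (+-identityʳ c)) (<⇒≤ two-columns)

      column-bound : ∀ {P a} → c ≤ a → P + a < l → c + P < l
      column-bound {P} {a} c≤a P+a<l = ≤-<-trans (≤-reflexive (+-comm c P)) (≤-<-trans (+-monoʳ-≤ P c≤a) P+a<l)

      row-bound : ∀ {Q b} → Q + b < m → Q < m
      row-bound {Q} {b} = ≤-<-trans (m≤m+n Q b)

      diagonal-budget : ∀ P Q → c + suc P < l → suc Q < m → suc P + suc Q ≤ d
      diagonal-budget P Q P-ok Q-ok =
        ≤-trans (+-mono-≤ (m≤m⊔n (suc P) 2) (m≤m⊔n (suc Q) 2)) (budget (suc P) (suc Q) P-ok Q-ok)

      row-budget : ∀ P → c + suc P < l → suc (suc P + 1) ≤ d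
      row-budget P P-ok = ≤-trans (≤-reflexive (sym (+-suc (suc P) 1)))
        (≤-trans (+-monoˡ-≤ 2 (m≤m⊔n (suc P) 2)) (budget (suc P) 0 P-ok (<⇒≤ two-rows)))

      column-budget : ∀ Q → suc Q < m → suc (1 + suc Q) ≤ d
      column-budget Q Q-ok = ≤-trans (+-monoʳ-≤ 2 (m≤m⊔n (suc Q) 2)) (budget 0 (suc Q) c<l Q-ok)

      last-column : ∀ {a} → a < l → ¬ suc a < l → ∃ λ a₀ → a ≡ suc a₀ × c ≤ a₀
      last-column {zero}   _ a+1≮l = ⊥-elim (a+1≮l (≤-trans (s≤s (s≤s z≤n)) two-columns))
      last-column {suc a₀} a<l a+1≮l = a₀ , refl , ≤-pred (≤-pred (≤-trans two-columns (≮⇒≥ a+1≮l)))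

    same-row-right : ∀ P {a b} → c ≤ a → suc P + a < l → b < m → ∀ t t′ →
                     Reach⁺ R (suc (suc P + 1)) ((a , b) , t) ((suc P + a , b) , t′)
    same-row-right P {a} {zero} c≤a a+P+1<l _ t t′ =
      reach⁺-cons (step-down c≤a (m+n<o⇒n<o (suc P) a+P+1<l) two-rows t) (walk-ne P 0 c≤a a+P+1<l two-rows _ t′)
    same-row-right P {a} {suc b} c≤a a+P+1<l b+1<m t t′ =
      reach⁺-cons (step-up c≤a (m+n<o⇒n<o (suc P) a+P+1<l) b+1<m t) (walk-se P 0 c≤a a+P+1<l b+1<m _ t′)

    same-row-left : ∀ P {a b} → c ≤ a → suc P + a < l → b < m → ∀ t t′ →
                    Reach⁺ R (suc (suc P + 1)) ((suc P + a , b) , t) ((a , b) , t′)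
    same-row-left P {a} {zero} c≤a a+P+1<l _ t t′ =
      reach⁺-cons (step-down (c≤+ (suc P) c≤a) a+P+1<l two-rows t) (walk-nw P 0 c≤a a+P+1<l two-rows _ t′)
    same-row-left P {a} {suc b} c≤a a+P+1<l b+1<m t t′ =
      reach⁺-cons (step-up (c≤+ (suc P) c≤a) a+P+1<l b+1<m t) (walk-sw P 0 c≤a a+P+1<l b+1<m _ t′)

    same-column-down : ∀ Q {a b} → c ≤ a → a < l → suc Q + b < m → ∀ t t′ →
                       Reach⁺ R (suc (1 + suc Q)) ((a , b) , t) ((a , suc Q + b) , t′)
    same-column-down Q {a} c≤a a<l b+Q+1<m t t′ with suc a <? l
    ... | yes a+1<l = reach⁺-cons (step-right c≤a a+1<l (m+n<o⇒n<o (suc Q) b+Q+1<m) t)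
                                  (walk-sw 0 Q c≤a a+1<l b+Q+1<m _ t′)
    ... | no a+1≮l with last-column a<l a+1≮l
    ...   | a₀ , refl , c≤a₀ = reach⁺-cons (step-left c≤a₀ a<l (m+n<o⇒n<o (suc Q) b+Q+1<m) t)
                                           (walk-se 0 Q c≤a₀ a<l b+Q+1<m _ t′)

    same-column-up : ∀ Q {a b} → c ≤ a → a < l → suc Q + b < m → ∀ t t′ →
                     Reach⁺ R (suc (1 + suc Q)) ((a , suc Q + b) , t) ((a , b) , t′)
    same-column-up Q {a} c≤a a<l b+Q+1<m t t′ with suc a <? l
    ... | yes a+1<l = reach⁺-cons (step-right c≤a a+1<l b+Q+1<m t) (walk-nw 0 Q c≤a a+1<l b+Q+1<m _ t′)
    ... | no a+1≮l with last-column a<l a+1≮l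
    ...   | a₀ , refl , c≤a₀ =
      reach⁺-cons (step-left c≤a₀ a<l b+Q+1<m t) (walk-ne 0 Q c≤a₀ a<l b+Q+1<m _ t′)

    twin : ∀ {a b} → c ≤ a → a < l → b < m → ∀ t t′ → Reach⁺ R 4 ((a , b) , t) ((a , b) , t′)
    twin {a} c≤a a<l b<m t t′ with suc a <? l
    ... | yes a+1<l = reach⁺-cons (step-right c≤a a+1<l b<m t) (same-row-left 0 c≤a a+1<l b<m _ t′)
    ... | no a+1≮l with last-column a<l a+1≮l
    ...   | a₀ , refl , c≤a₀ =
      reach⁺-cons (step-left c≤a₀ a<l b<m t) (same-row-right 0 c≤a₀ a<l b<m _ t′)

    region-walk : ∀ {a b a′ b′} t t′ → c ≤ a → c ≤ a′ → a < l → b < m → a′ < l → b′ < m →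
                  Reach⁺ R d ((a , b) , t) ((a′ , b′) , t′)
    region-walk {a} {b} {a′} {b′} t t′ c≤a c≤a′ a<l b<m a′<l b′<m with <-cmp a a′ | <-cmp b b′
    region-walk t t′ c≤a c≤a′ a<l b<m a′<l b′<m | tri< a<a′ _ _ | tri< b<b′ _ _
      with <⇒offset a<a′ | <⇒offset b<b′
    ...   | offset P | offset Q =
      reach⁺-mono (diagonal-budget P Q (column-bound c≤a a′<l) (row-bound b′<m))
                  (walk-se P Q c≤a a′<l b′<m t t′)
    region-walk t t′ c≤a c≤a′ a<l b<m a′<l b′<m | tri< a<a′ _ _ | tri> _ _ b′<b
      with <⇒offset a<a′ | <⇒offset b′<b
    ...   | offset P | offset Q =
      reach⁺-mono (diagonal-budget P Q (column-bound c≤a a′<l) (row-bound b<m))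
                  (walk-ne P Q c≤a a′<l b<m t t′)
    region-walk t t′ c≤a c≤a′ a<l b<m a′<l b′<m | tri> _ _ a′<a | tri< b<b′ _ _
      with <⇒offset a′<a | <⇒offset b<b′
    ...   | offset P | offset Q =
      reach⁺-mono (diagonal-budget P Q (column-bound c≤a′ a<l) (row-bound b′<m))
                  (walk-sw P Q c≤a′ a<l b′<m t t′)
    region-walk t t′ c≤a c≤a′ a<l b<m a′<l b′<m | tri> _ _ a′<a | tri> _ _ b′<b
      with <⇒offset a′<a | <⇒offset b′<b
    ...   | offset P | offset Q =
      reach⁺-mono (diagonal-budget P Q (column-bound c≤a′ a<l) (row-bound b<m))
                  (walk-nw P Q c≤a′ a<l b<m t t′)
    region-walk t t′ c≤a c≤a′ a<l b<m a′<l b′<m | tri< a<a′ _ _ | tri≈ _ refl _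
      with <⇒offset a<a′
    ...   | offset P = reach⁺-mono (row-budget P (column-bound c≤a a′<l)) (same-row-right P c≤a a′<l b<m t t′)
    region-walk t t′ c≤a c≤a′ a<l b<m a′<l b′<m | tri> _ _ a′<a | tri≈ _ refl _
      with <⇒offset a′<a
    ...   | offset P = reach⁺-mono (row-budget P (column-bound c≤a′ a<l)) (same-row-left P c≤a′ a<l b<m t t′)
    region-walk t t′ c≤a c≤a′ a<l b<m a′<l b′<m | tri≈ _ refl _ | tri< b<b′ _ _
      with <⇒offset b<b′
    ...   | offset Q = reach⁺-mono (column-budget Q (row-bound b′<m)) (same-column-down Q c≤a a<l b′<m t t′)
    region-walk t t′ c≤a c≤a′ a<l b<m a′<l b′<m | tri≈ _ refl _ | tri> _ _ b′<b
      with <⇒offset b′<b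
    ...   | offset Q = reach⁺-mono (column-budget Q (row-bound b<m)) (same-column-up Q c≤a a<l b<m t t′)
    region-walk t t′ c≤a c≤a′ a<l b<m a′<l b′<m | tri≈ _ refl _ | tri≈ _ refl _ =
      reach⁺-mono (budget 0 0 c<l (<⇒≤ two-rows)) (twin c≤a a<l b<m t t′)

-- P_λ × P_μ with λ ≥ μ ≥ 3

parity-spans : ∀ {l m d} → 1 ≤ l → 1 ≤ m → (l ⊔ 2) + (m ⊔ 2) ≤ d → Spans (suc l) (suc m) parity d
parity-spans {l} {m} 1≤l 1≤m fits ((i , j) , t) ((i′ , j′) , t′) =
  region-walk t t′ z≤n z≤n (toℕ<n i) (toℕ<n j) (toℕ<n i′) (toℕ<n j′)
  where
    open ParityRegion (Step (suc l) (suc m) parity) (suc l) (suc m) 0 (parity-steps _ _)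
    open Spanning (s≤s 1≤l) (s≤s 1≤m)
      (λ P Q P<l Q<m → ≤-trans (+-mono-≤ (⊔-monoˡ-≤ 2 (≤-pred P<l)) (⊔-monoˡ-≤ 2 (≤-pred Q<m))) fits)

grid-inC0 : ∀ {l m} → 3 ≤ m → m ≤ l → (s : V (Grid l m) → ℕ) → ((x : V (Grid l m)) → 2 ≤ s x) →
            InC 0 (Grid l m) s
grid-inC0 {suc l} {suc m} (s≤s 2≤m) (s≤s m≤l) s hs =
  design-inC0 s hs parity parity-anti (parity-spans (<⇒≤ 2≤l) (<⇒≤ 2≤m) fits)
  where
    2≤l = ≤-trans 2≤m m≤l
    fits : (l ⊔ 2) + (m ⊔ 2) ≤ l + m
    fits = ≤-reflexive (cong₂ _+_ (m≥n⇒m⊔n≡m 2≤l) (m≥n⇒m⊔n≡m 2≤m))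

-- P_λ × P₂ with λ ≥ 4

ladder : Design
ladder (0 , _) t (1 , _) t′ = not t′
ladder (1 , _) t (0 , _) t′ = t
ladder (1 , _) t (2 , _) t′ = not t
ladder (2 , _) t (1 , _) t′ = t′
ladder (1 , 0) t (1 , 1) t′ = not t′
ladder (1 , 1) t (1 , 0) t′ = t
ladder x       t y       t′ = parity x t y t′

ladder-parity : ∀ {a a′} b b′ t t′ → 2 ≤ a → 2 ≤ a′ →
                ladder (a , b) t (a′ , b′) t′ ≡ parity (a , b) t (a′ , b′) t′
ladder-parity {2}                 {2}                 _ _ _ _ _ _ = refl
ladder-parity {2}                 {suc (suc (suc _))} _ _ _ _ _ _ = refl
ladder-parity {suc (suc (suc _))} {suc (suc _)}       _ _ _ _ _ _ = refl
ladder-parity {suc (suc _)}       {suc zero}          _ _ _ _ _ (s≤s ())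
ladder-parity {suc zero}          {_}                 _ _ _ _ (s≤s ()) _

ladder-down-anti : ∀ a b t t′ → ladder (a , suc b) t′ (a , b) t ≡ not (ladder (a , b) t (a , suc b) t′)
ladder-down-anti 0 b t t′ = parity-anti {0 , b} {0 , suc b} (inj₁ (refl , inj₁ refl)) t t′
ladder-down-anti 1 0 t t′ = sym (not-involutive t′)
ladder-down-anti 1 1 t t′ = parity-anti {1 , 1} {1 , 2} (inj₁ (refl , inj₁ refl)) t t′
ladder-down-anti 1 (suc (suc b)) t t′ = parity-anti {1 , 2 + b} {1 , 3 + b} (inj₁ (refl , inj₁ refl)) t t′
ladder-down-anti 2 b t t′ = parity-anti {2 , b} {2 , suc b} (inj₁ (refl , inj₁ refl)) t t′
ladder-down-anti (suc (suc (suc a))) b t t′ = parity-anti {3 + a , b} {3 + a , suc b} (inj₁ (refl , inj₁ refl)) t t′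

ladder-right-anti : ∀ a b t t′ → ladder (suc a , b) t′ (a , b) t ≡ not (ladder (a , b) t (suc a , b) t′)
ladder-right-anti 0 b t t′ = sym (not-involutive t′)
ladder-right-anti 1 b t t′ = sym (not-involutive t)
ladder-right-anti 2 b t t′ = parity-anti {2 , b} {3 , b} (inj₂ (inj₁ refl , refl)) t t′
ladder-right-anti (suc (suc (suc a))) b t t′ = parity-anti {3 + a , b} {4 + a , b} (inj₂ (inj₁ refl , refl)) t t′

not-swap : ∀ {p q} → p ≡ not q → q ≡ not p
not-swap {q = q} p≡not-q = trans (sym (not-involutive q)) (cong not (sym p≡not-q))

ladder-anti : Antisymmetric ladder
ladder-anti {a , b} (inj₁ (refl , inj₁ refl)) t t′     = ladder-down-anti a b t t′
ladder-anti {a , suc b} (inj₁ (refl , inj₂ refl)) t t′ = not-swap (ladder-down-anti a b t′ t)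
ladder-anti {a , b} (inj₂ (inj₁ refl , refl)) t t′     = ladder-right-anti a b t t′
ladder-anti {suc a , b} (inj₂ (inj₂ refl , refl)) t t′ = not-swap (ladder-right-anti a b t′ t)

ladder-steps : ∀ l m → ParityStepsFrom (Step l m ladder) l m 2
ladder-steps l m {a , b} {a′ , b′} adj 2≤a 2≤a′ x∈box y∈box t =
  x∈box , y∈box , adj ,
  trans (ladder-parity b b′ t _ 2≤a 2≤a′) (cong not (xor-same (t xor parityFlip (a , b) (a′ , b′))))

CellStep : ∀ l m → Design → Cell l m → Cell l m → Set
CellStep l m δ c c′ = Step l m δ (cellState c) (cellState c′)

searchable-Cell : ∀ l m → Searchable (Cell l m)
searchable-Cell l m = searchable-× (searchable-× (searchable-Fin l) (searchable-Fin m)) searchable-Bool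

cellSpans? : ∀ l m δ d → Dec ((c c′ : Cell l m) → Reach⁺ (CellStep l m δ) d c c′)
cellSpans? l m δ d = searchable-∀ (searchable-Cell l m) λ c → searchable-∀ (searchable-Cell l m) λ c′ →
  reach⁺? (searchable-Cell l m) (≡-dec (≡-dec _≟ᶠ_ _≟ᶠ_) _≟ᵇ_)
          (λ c c′ → step? l m δ (cellState c) (cellState c′)) d c c′

ladder-window : Spans 4 2 ladder 4
ladder-window c c′ = reach⁺-map cellState (λ st → st) (from-yes (cellSpans? 4 2 ladder 4) c c′)

ladder-spans : ∀ {l} → 4 ≤ l → Spans l 2 ladder l
ladder-spans {l} 4≤l ((i , j) , t) ((i′ , j′) , t′) =
  ladder-walk (toℕ<n i) (toℕ<n j) (toℕ<n i′) (toℕ<n j′)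
  where
    open ParityRegion (Step l 2 ladder) l 2 2 (ladder-steps l 2)

    budget : ∀ P Q → 2 + P < l → Q < 2 → (P ⊔ 2) + (Q ⊔ 2) ≤ l
    budget P Q 2+P<l (s≤s Q≤1) = begin
      (P ⊔ 2) + (Q ⊔ 2) ≡⟨ cong ((P ⊔ 2) +_) (m≤n⇒m⊔n≡n (m≤n⇒m≤1+n Q≤1)) ⟩
      (P ⊔ 2) + 2       ≡⟨ +-distribʳ-⊔ 2 P 2 ⟩
      (P + 2) ⊔ 4       ≤⟨ ⊔-lub (≤-trans (≤-reflexive (+-comm P 2)) (<⇒≤ 2+P<l)) 4≤l ⟩
      l                 ∎
      where open ≤-Reasoning

    open Spanning 4≤l (s≤s (s≤s z≤n)) budget

    window : ∀ {a b a′ b′} t t′ → a < 4 → b < 2 → a′ < 4 → b′ < 2 →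
             Reach⁺ (Step l 2 ladder) 4 ((a , b) , t) ((a′ , b′) , t′)
    window t t′ a<4 b<2 a′<4 b′<2 =
      reach⁺-map (λ σ → σ) (step-widen {m = 2} {ladder} 4≤l)
        (subst₂ (Reach⁺ (Step 4 2 ladder) 4) (cell-state a<4 b<2 t) (cell-state a′<4 b′<2 t′)
                (ladder-window ((fromℕ< a<4 , fromℕ< b<2) , t) ((fromℕ< a′<4 , fromℕ< b′<2) , t′)))
      where
        cell-state : ∀ {a b} (a<4 : a < 4) (b<2 : b < 2) t →
                     cellState ((fromℕ< a<4 , fromℕ< b<2) , t) ≡ ((a , b) , t)
        cell-state a<4 b<2 t = cong (_, t) (cong₂ _,_ (toℕ-fromℕ< a<4) (toℕ-fromℕ< b<2))

    k+4≤l : ∀ k → suc k + 3 < l → suc k + 4 ≤ l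
    k+4≤l k k+3<l = ≤-trans (≤-reflexive (+-suc (suc k) 3)) k+3<l

    ≱2⇒<4 : ∀ {a} → ¬ 2 ≤ a → a < 4
    ≱2⇒<4 a≱2 = <-trans (≰⇒> a≱2) (s≤s (s≤s (s≤s z≤n)))

    -- Pairs in columns 0–3 are joined inside the window and pairs in columns ≥ 2 by the parity
    -- design; otherwise the walk passes the window through column 3 and runs along a row.
    ladder-walk : ∀ {a b a′ b′} → a < l → b < 2 → a′ < l → b′ < 2 →
                  Reach⁺ (Step l 2 ladder) l ((a , b) , t) ((a′ , b′) , t′)
    ladder-walk {a} {b} {a′} {b′} a<l b<2 a′<l b′<2 with 2 ≤? a | 2 ≤? a′
    ... | yes 2≤a | yes 2≤a′ = region-walk t t′ 2≤a 2≤a′ a<l b<2 a′<l b′<2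
    ... | no a≱2 | _ with a′ <? 4
    ...   | yes a′<4 = reach⁺-mono 4≤l (window t t′ (≱2⇒<4 a≱2) b<2 a′<4 b′<2)
    ...   | no a′≮4 with <⇒offset (≮⇒≥ a′≮4)
    ...     | offset k = reach⁺-mono (≤-trans (≤-reflexive (+-comm 4 (suc k))) (k+4≤l k a′<l))
                           (reach⁺-++ (window t t′ (≱2⇒<4 a≱2) b<2 ≤-refl b′<2)
                                      (row-right (suc k) (n≤1+n 2) a′<l b′<2 t′))
    ladder-walk {a} {b} {a′} {b′} a<l b<2 a′<l b′<2 | yes 2≤a | no a′≱2 with a <? 4
    ... | yes a<4 = reach⁺-mono 4≤l (window t t′ a<4 b<2 (≱2⇒<4 a′≱2) b′<2)
    ... | no a≮4 with <⇒offset (≮⇒≥ a≮4)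
    ...   | offset k with row-left (suc k) (n≤1+n 2) a<l b<2 t
    ...     | t₂ , row =
      reach⁺-mono (k+4≤l k a<l) (reach-++⁺ row (window t₂ t′ ≤-refl b<2 (≱2⇒<4 a′≱2) b′<2))

ladder-inC0 : ∀ {l} → 4 ≤ l → (s : V (Grid l 2) → ℕ) → ((x : V (Grid l 2)) → 2 ≤ s x) →
              InC 0 (Grid l 2) s
ladder-inC0 {suc l} 4≤l s hs =
  design-inC0 s hs ladder ladder-anti (subst (Spans (suc l) 2 ladder) (+-comm 1 l) (ladder-spans 4≤l))

-- P₃ × P₂

Tuple : (n : ℕ) → (Fin n → Set) → Set
Tuple zero    A = ⊤
Tuple (suc n) A = A zero × Tuple n (A ∘ suc)

lookupᵗ : ∀ {n A} → Tuple n A → (k : Fin n) → A k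
lookupᵗ (a , _)  zero    = a
lookupᵗ (_ , as) (suc k) = lookupᵗ as k

tabulateᵗ : ∀ {n A} → ((k : Fin n) → A k) → Tuple n A
tabulateᵗ {zero}  f = tt
tabulateᵗ {suc n} f = f zero , tabulateᵗ (f ∘ suc)

lookup-tabulate : ∀ {n A} (f : (k : Fin n) → A k) k → lookupᵗ {n} {A} (tabulateᵗ f) k ≡ f k
lookup-tabulate f zero    = refl
lookup-tabulate f (suc k) = lookup-tabulate (f ∘ suc) k

searchable-Tuple : ∀ {n A} → ((k : Fin n) → Searchable (A k)) → Searchable (Tuple n A)
searchable-Tuple {zero}  _      P? = map′ (tt ,_) proj₂ (P? tt)
searchable-Tuple {suc n} search    = searchable-× (search zero) (searchable-Tuple (search ∘ suc))

G₃₂ : Graph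
G₃₂ = Grid 3 2

_≟ᵛ_ : DecidableEquality (V G₃₂)
_≟ᵛ_ = ≡-dec _≟ᶠ_ _≟ᶠ_

-- Every edge of P₃ × P₂ once; the certificate below refers to them by their index.
edges : Vec (V G₃₂ × V G₃₂) 7
edges = ((# 0 , # 0) , (# 1 , # 0)) ∷ ((# 1 , # 0) , (# 2 , # 0)) ∷ ((# 0 , # 1) , (# 1 , # 1))
      ∷ ((# 1 , # 1) , (# 2 , # 1)) ∷ ((# 0 , # 0) , (# 0 , # 1)) ∷ ((# 1 , # 0) , (# 1 , # 1))
      ∷ ((# 2 , # 0) , (# 2 , # 1)) ∷ []

src tgt : Fin 7 → V G₃₂
src k = proj₁ (lookup edges k)
tgt k = proj₂ (lookup edges k)

Listed : V G₃₂ → V G₃₂ → Set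
Listed x y = ∃ λ k → src k ≡ x × tgt k ≡ y

listed? : ∀ x y → Dec (Listed x y)
listed? x y = any? λ k → (src k ≟ᵛ x) ×-dec (tgt k ≟ᵛ y)

listed-isEdge : ∀ k → E G₃₂ (src k) (tgt k)
listed-isEdge = from-yes (all? λ k → grid? (src k) (tgt k))

edge-listed : ∀ x y → E G₃₂ x y → Listed x y ⊎ Listed y x
edge-listed = from-yes (searchable-∀ search λ x → searchable-∀ search λ y →
                          grid? x y →-dec (listed? x y ⊎-dec listed? y x))
  where search = searchable-× (searchable-Fin 3) (searchable-Fin 2)

listed-antisym : ∀ {x y} → Listed x y → Listed y x → ⊥
listed-antisym (k , refl , refl) (k′ , src-k′ , tgt-k′) = no-2-cycle k k′ (src-k′ , tgt-k′)
  where
    no-2-cycle : ∀ k k′ → ¬ (src k′ ≡ tgt k × tgt k′ ≡ src k)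
    no-2-cycle = from-yes (all? λ k → all? λ k′ → ¬? ((src k′ ≟ᵛ tgt k) ×-dec (tgt k′ ≟ᵛ src k)))

data Direction (x y : V G₃₂) : Set where
  forward  : Listed x y → Direction x y
  backward : Listed y x → Direction x y
  neither  : Direction x y

direction : ∀ x y → Direction x y
direction x y with listed? x y | listed? y x
... | yes xy | _      = forward xy
... | no _   | yes yx = backward yx
... | no _   | no _   = neither

reverse : ∀ {x y} → Direction x y → Direction y x
reverse (forward xy)  = backward xy
reverse (backward yx) = forward yx
reverse neither       = neither

direction-swap : ∀ x y → direction y x ≡ reverse (direction x y)
direction-swap x y with listed? x y | listed? y x
... | yes xy | yes yx = ⊥-elim (listed-antisym xy yx)
... | yes _  | no _   = refl
... | no _   | yes _  = refl
... | no _   | no _   = refl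

direction-edge : ∀ x y → E G₃₂ x y → direction x y ≢ neither
direction-edge x y e with listed? x y | listed? y x
... | yes _  | _      = λ ()
... | no _   | yes _  = λ ()
... | no ¬xy | no ¬yx = λ _ → [ ¬xy , ¬yx ]′ (edge-listed x y e)

module Orientations₃₂ (s : V G₃₂ → ℕ) where

  X = VMult G₃₂ s

  -- π k p q = just true orients the edge between copy p over src k and copy q over tgt k
  -- forwards; nothing leaves both directions possible.
  Partial : Set
  Partial = (k : Fin 7) → Fin (s (src k)) → Fin (s (tgt k)) → Maybe Bool

  Row : Fin 7 → Set
  Row k = Tuple (s (src k)) λ _ → Tuple (s (tgt k)) λ _ → Bool

  -- Nested tuples rather than functions, so that the choices form a searchable type.
  Choice : Set
  Choice = Tuple 7 Row

  bit : Choice → (k : Fin 7) → Fin (s (src k)) → Fin (s (tgt k)) → Bool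
  bit ρ k p q =
    lookupᵗ {A = λ _ → Bool} (lookupᵗ {A = λ _ → Tuple _ λ _ → Bool} (lookupᵗ {A = Row} ρ k) p) q

  tabulateChoice : ((k : Fin 7) → Fin (s (src k)) → Fin (s (tgt k)) → Bool) → Choice
  tabulateChoice f = tabulateᵗ {A = Row} λ k →
    tabulateᵗ {A = λ _ → Tuple (s (tgt k)) λ _ → Bool} λ p → tabulateᵗ {A = λ _ → Bool} (f k p)

  bit-tabulate : ∀ f k p q → bit (tabulateChoice f) k p q ≡ f k p q
  bit-tabulate f k p q
    rewrite lookup-tabulate {A = Row} (λ k → tabulateᵗ {A = λ _ → Tuple (s (tgt k)) λ _ → Bool} λ p →
                                          tabulateᵗ {A = λ _ → Bool} (f k p)) k
          | lookup-tabulate {A = λ _ → Tuple (s (tgt k)) λ _ → Bool}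
                            (λ p → tabulateᵗ {A = λ _ → Bool} (f k p)) p
          = lookup-tabulate {A = λ _ → Bool} (f k p) q

  total : Choice → Partial
  total ρ k p q = just (bit ρ k p q)

  permitsAlong : ∀ {x y} → Partial → Direction x y → Fin (s x) → Fin (s y) → Bool
  permitsAlong π (forward (k , refl , refl))  p q = maybe′ (λ b → b) true (π k p q)
  permitsAlong π (backward (k , refl , refl)) p q = maybe′ not true (π k q p)
  permitsAlong π neither                      p q = false

  Permitted : Partial → V X → V X → Set
  Permitted π = Chosen (E X) λ (x , p) (y , q) → permitsAlong π (direction x y) p q

  Oriented : Choice → V X → V X → Set
  Oriented ρ = Permitted (total ρ)

  oriented-isOrientation : ∀ ρ → IsOrientation (E X) (Oriented ρ)
  oriented-isOrientation ρ = chosen-isOrientation (vmult-sym {G₃₂} grid-sym) _ λ {(x , p)} {(y , q)} (_ , e) →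
    subst (λ d → permitsAlong (total ρ) d q p ≡ not (permitsAlong (total ρ) (direction x y) p q))
          (sym (direction-swap x y)) (along-reverse (direction x y) (direction-edge x y e))
    where
      along-reverse : ∀ {x y p q} (d : Direction x y) → d ≢ neither →
                      permitsAlong (total ρ) (reverse d) q p ≡ not (permitsAlong (total ρ) d p q)
      along-reverse (forward (k , refl , refl))  _ = refl
      along-reverse (backward (k , refl , refl)) _ = sym (not-involutive _)
      along-reverse neither                      d≢neither = ⊥-elim (d≢neither refl)

  fibre-edge : ∀ k p q → E X (src k , p) (tgt k , q)
  fibre-edge k p q =
    (λ src≡tgt → grid-irrefl (subst (E G₃₂ (src k)) (sym src≡tgt) (listed-isEdge k))) , listed-isEdge k

  fromSide : {A B : Set} → A ⊎ B → Bool
  fromSide = [ (λ _ → true) , (λ _ → false) ]′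

  preference : ∀ {D} → IsOrientation (E X) D → (k : Fin 7) → Fin (s (src k)) → Fin (s (tgt k)) → Bool
  preference (_ , either , _) k p q = fromSide (either (src k , p) (tgt k , q) (fibre-edge k p q))

  choiceOf : ∀ {D} → IsOrientation (E X) D → Choice
  choiceOf o = tabulateChoice (preference o)

  choiceOf-permits : ∀ {D} (o : IsOrientation (E X) D) {x y p q} → D (x , p) (y , q) →
                     (dir : Direction x y) → dir ≢ neither → permitsAlong (total (choiceOf o)) dir p q ≡ true
  choiceOf-permits o@(_ , either , asym) {p = p} {q} d (forward (k , refl , refl)) _ =
    trans (bit-tabulate (preference o) k p q) (left (either _ _ (fibre-edge k p q)))
    where left : ∀ r → fromSide r ≡ true
          left (inj₁ _)  = refl
          left (inj₂ d′) = ⊥-elim (asym _ _ (d , d′))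
  choiceOf-permits o@(_ , either , asym) {p = p} {q} d (backward (k , refl , refl)) _ =
    cong not (trans (bit-tabulate (preference o) k q p) (right (either _ _ (fibre-edge k q p))))
    where right : ∀ r → fromSide r ≡ false
          right (inj₁ d′) = ⊥-elim (asym _ _ (d , d′))
          right (inj₂ _)  = refl
  choiceOf-permits o d neither neither≢neither = ⊥-elim (neither≢neither refl)

  orientation⊆choiceOf : ∀ {D} (o : IsOrientation (E X) D) {u v} → D u v → Oriented (choiceOf o) u v
  orientation⊆choiceOf o@(D⊆E , _) {x , p} {y , q} d =
    D⊆E _ _ d , choiceOf-permits o d (direction x y) (direction-edge x y (proj₂ (D⊆E _ _ d)))

  choiceOf-diam : ∀ {D d} (o : IsOrientation (E X) D) → DiamAtMost D d → DiamAtMost (Oriented (choiceOf o)) d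
  choiceOf-diam {D} o diam u v =
    reach-map {R = D} {S = Oriented (choiceOf o)} (λ w → w) (orientation⊆choiceOf o) (diam u v)

  Extends : Partial → Choice → Set
  Extends π ρ = ∀ k p q → AllMaybe (_≡ bit ρ k p q) (π k p q)

  permitsAlong-mono : ∀ {π ρ} → Extends π ρ → ∀ {x y p q} (dir : Direction x y) →
                      permitsAlong (total ρ) dir p q ≡ true → permitsAlong π dir p q ≡ true
  permitsAlong-mono {π} ext {p = p} {q} (forward (k , refl , refl)) ok with π k p q | ext k p q
  ... | nothing | _         = refl
  ... | just _  | just refl = ok
  permitsAlong-mono {π} ext {p = p} {q} (backward (k , refl , refl)) ok with π k q p | ext k q p
  ... | nothing | _         = refl
  ... | just _  | just refl = ok

  permitted-mono : ∀ {π ρ} → Extends π ρ → ∀ {u v} → Oriented ρ u v → Permitted π u v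
  permitted-mono ext {x , _} {y , _} (e , ok) = e , permitsAlong-mono ext (direction x y) ok

  searchable-X : Searchable (V X)
  searchable-X = searchable-Σ (searchable-× (searchable-Fin 3) (searchable-Fin 2)) (λ x → searchable-Fin (s x))

  permitted? : ∀ π u v → Dec (Permitted π u v)
  permitted? π (x , p) (y , q) =
    (¬? (x ≟ᵛ y) ×-dec grid? x y) ×-dec (permitsAlong π (direction x y) p q ≟ᵇ true)

  reach-permitted? : ∀ π k u v → Dec (Reach (Permitted π) k u v)
  reach-permitted? π = reach? searchable-X (≡-dec _≟ᵛ_ _≟ᶠ_) (permitted? π)

  ShortOrientation : Set
  ShortOrientation = ∃ λ ρ → DiamAtMost (Oriented ρ) 3

  shortOrientation? : Dec ShortOrientation
  shortOrientation? =
    searchable-Tuple {A = Row} (λ k → searchable-Tuple {A = λ _ → Tuple (s (tgt k)) λ _ → Bool} λ _ →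
                                        searchable-Tuple {A = λ _ → Bool} λ _ → searchable-Bool) λ ρ →
      searchable-∀ searchable-X λ u → searchable-∀ searchable-X λ v → reach-permitted? (total ρ) 3 u v

  module _ (hs : (x : V G₃₂) → 2 ≤ s x) where

    short⇒inC0 : ShortOrientation → InC 0 G₃₂ s
    short⇒inC0 (ρ , diam) = inC-intro hs grid-hasDiam refl (oriented-isOrientation ρ) diam (vmult-diam-lower hs)

    ¬short⇒inC1 : ¬ ShortOrientation → InC 1 G₃₂ s
    ¬short⇒inC1 ¬short =
      inC-intro hs grid-hasDiam refl arc-isOrientation
                (spans⇒diam (parity-spans (s≤s z≤n) (s≤s z≤n) ≤-refl)) 4≤
      where
        open DesignOrientation s hs parity parity-anti using (arc-isOrientation; spans⇒diam)
        4≤ : ∀ {D d} → IsOrientation (E X) D → DiamAtMost D d → 4 ≤ d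
        4≤ {d = d} o diam with 4 ≤? d
        ... | yes 4≤d = 4≤d
        ... | no 4≰d  = ⊥-elim (¬short (choiceOf o ,
                          choiceOf-diam o λ u v → reach-mono (≤-pred (≰⇒> 4≰d)) (diam u v)))

    inC0⊎inC1 : InC 0 G₃₂ s ⊎ InC 1 G₃₂ s
    inC0⊎inC1 = by-cases shortOrientation?
      where
        by-cases : Dec ShortOrientation → InC 0 G₃₂ s ⊎ InC 1 G₃₂ s
        by-cases (yes short) = inj₁ (short⇒inC0 short)
        by-cases (no ¬short) = inj₂ (¬short⇒inC1 ¬short)

module Refutation₃₂ where

  open Orientations₃₂ (λ _ → 2)

  data Refutation : Set where
    unreachable : V X → V X → Refutation
    branch      : Fin 7 → Fin 2 → Fin 2 → Refutation → Refutation → Refutation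

  assign : Partial → Fin 7 → Fin 2 → Fin 2 → Bool → Partial
  assign π k p q b k′ p′ q′ with ≡-dec _≟ᶠ_ (≡-dec _≟ᶠ_ _≟ᶠ_) (k , p , q) (k′ , p′ , q′)
  ... | yes _ = just b
  ... | no _  = π k′ p′ q′

  extends-assign : ∀ {π ρ} → Extends π ρ → ∀ k p q → Extends (assign π k p q (bit ρ k p q)) ρ
  extends-assign ext k p q k′ p′ q′ with ≡-dec _≟ᶠ_ (≡-dec _≟ᶠ_ _≟ᶠ_) (k , p , q) (k′ , p′ , q′)
  ... | yes refl = just refl
  ... | no _     = ext k′ p′ q′

  refutes : Partial → Refutation → Bool
  refutes π (unreachable u v)  = isNo (reach-permitted? π 3 u v)
  refutes π (branch k p q r r′) = refutes (assign π k p q true) r ∧ refutes (assign π k p q false) r′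

  refutes-sound : ∀ r {π ρ} → Extends π ρ → T (refutes π r) → ¬ DiamAtMost (Oriented ρ) 3
  refutes-sound (unreachable u v) ext ok diam =
    toWitnessFalse ok (reach-map (λ w → w) (permitted-mono ext) (diam u v))
  refutes-sound (branch k p q r r′) {π} {ρ} ext ok with bit ρ k p q in bit≡
  ... | true  = refutes-sound r (subst (λ b → Extends (assign π k p q b) ρ) bit≡ (extends-assign ext k p q))
                              (proj₁ (Equivalence.to T-∧ ok))
  ... | false = refutes-sound r′ (subst (λ b → Extends (assign π k p q b) ρ) bit≡ (extends-assign ext k p q))
                               (proj₂ (Equivalence.to T-∧ ok))

  -- Found by a computer search. `branch k p q` splits on the direction of the edge between copy p
  -- over src k and copy q over tgt k (forwards first); each leaf names a pair of vertices that no
  -- completion of the directions fixed so far joins within 3 steps.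
  certificate : Refutation
  certificate =
    branch (# 0) (# 0) (# 0) (branch (# 1) (# 1) (# 0) (unreachable ((# 2 , # 0) , # 0) ((# 0 , # 0) , # 0))
    (branch (# 1) (# 0) (# 0) (branch (# 0) (# 0) (# 1)
    (unreachable ((# 2 , # 0) , # 0) ((# 0 , # 0) , # 0)) (branch (# 0) (# 1) (# 0)
    (branch (# 0) (# 1) (# 1) (unreachable ((# 2 , # 0) , # 0) ((# 0 , # 0) , # 1))
    (branch (# 1) (# 0) (# 1) (branch (# 1) (# 1) (# 1)
    (unreachable ((# 2 , # 0) , # 1) ((# 0 , # 0) , # 0)) (branch (# 2) (# 0) (# 0)
    (branch (# 2) (# 0) (# 1) (unreachable ((# 1 , # 0) , # 0) ((# 0 , # 1) , # 0))
    (branch (# 2) (# 1) (# 0) (branch (# 2) (# 1) (# 1)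
    (unreachable ((# 1 , # 0) , # 0) ((# 0 , # 1) , # 1)) (branch (# 5) (# 0) (# 1)
    (branch (# 3) (# 0) (# 0) (unreachable ((# 2 , # 1) , # 0) ((# 1 , # 0) , # 0))
    (unreachable ((# 0 , # 1) , # 0) ((# 2 , # 1) , # 0)))
    (unreachable ((# 0 , # 0) , # 0) ((# 1 , # 1) , # 1)))) (branch (# 2) (# 1) (# 1)
    (branch (# 3) (# 0) (# 0) (unreachable ((# 2 , # 1) , # 0) ((# 0 , # 1) , # 1))
    (unreachable ((# 0 , # 1) , # 0) ((# 2 , # 1) , # 0)))
    (unreachable ((# 0 , # 1) , # 1) ((# 1 , # 0) , # 1))))) (branch (# 2) (# 0) (# 1)
    (branch (# 2) (# 1) (# 0) (branch (# 2) (# 1) (# 1)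
    (unreachable ((# 1 , # 0) , # 0) ((# 0 , # 1) , # 1)) (branch (# 3) (# 0) (# 0)
    (unreachable ((# 2 , # 1) , # 0) ((# 0 , # 1) , # 0))
    (unreachable ((# 0 , # 1) , # 1) ((# 2 , # 1) , # 0)))) (branch (# 5) (# 0) (# 0)
    (branch (# 2) (# 1) (# 1) (branch (# 3) (# 0) (# 0)
    (unreachable ((# 2 , # 1) , # 0) ((# 0 , # 1) , # 0)) (branch (# 3) (# 0) (# 1)
    (unreachable ((# 2 , # 1) , # 1) ((# 0 , # 1) , # 0))
    (unreachable ((# 1 , # 1) , # 0) ((# 2 , # 0) , # 0))))
    (unreachable ((# 0 , # 1) , # 1) ((# 1 , # 0) , # 1)))
    (unreachable ((# 0 , # 0) , # 0) ((# 1 , # 1) , # 0))))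
    (unreachable ((# 0 , # 1) , # 0) ((# 1 , # 0) , # 1)))))
    (unreachable ((# 0 , # 0) , # 0) ((# 2 , # 0) , # 1))))
    (unreachable ((# 0 , # 0) , # 1) ((# 2 , # 0) , # 0))))
    (unreachable ((# 0 , # 0) , # 0) ((# 2 , # 0) , # 0)))) (branch (# 0) (# 0) (# 1)
    (branch (# 1) (# 1) (# 0) (branch (# 0) (# 1) (# 0)
    (unreachable ((# 2 , # 0) , # 0) ((# 0 , # 0) , # 1)) (branch (# 0) (# 1) (# 1)
    (branch (# 1) (# 0) (# 0) (unreachable ((# 2 , # 0) , # 0) ((# 0 , # 0) , # 0))
    (branch (# 1) (# 0) (# 1) (unreachable ((# 2 , # 0) , # 1) ((# 0 , # 0) , # 0))
    (branch (# 1) (# 1) (# 1) (branch (# 2) (# 0) (# 0) (branch (# 2) (# 0) (# 1)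
    (unreachable ((# 1 , # 0) , # 1) ((# 0 , # 1) , # 0)) (branch (# 2) (# 1) (# 0)
    (branch (# 2) (# 1) (# 1) (unreachable ((# 1 , # 0) , # 1) ((# 0 , # 1) , # 1))
    (branch (# 5) (# 1) (# 1) (branch (# 3) (# 0) (# 0)
    (unreachable ((# 2 , # 1) , # 0) ((# 1 , # 0) , # 1))
    (unreachable ((# 0 , # 1) , # 0) ((# 2 , # 1) , # 0)))
    (unreachable ((# 0 , # 0) , # 0) ((# 1 , # 1) , # 1)))) (branch (# 2) (# 1) (# 1)
    (branch (# 3) (# 0) (# 0) (unreachable ((# 2 , # 1) , # 0) ((# 0 , # 1) , # 1))
    (unreachable ((# 0 , # 1) , # 0) ((# 2 , # 1) , # 0)))
    (unreachable ((# 0 , # 1) , # 1) ((# 1 , # 0) , # 0))))) (branch (# 2) (# 0) (# 1)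
    (branch (# 2) (# 1) (# 0) (branch (# 2) (# 1) (# 1)
    (unreachable ((# 1 , # 0) , # 1) ((# 0 , # 1) , # 1)) (branch (# 3) (# 0) (# 0)
    (unreachable ((# 2 , # 1) , # 0) ((# 0 , # 1) , # 0))
    (unreachable ((# 0 , # 1) , # 1) ((# 2 , # 1) , # 0)))) (branch (# 5) (# 1) (# 0)
    (branch (# 2) (# 1) (# 1) (branch (# 3) (# 0) (# 0)
    (unreachable ((# 2 , # 1) , # 0) ((# 0 , # 1) , # 0)) (branch (# 3) (# 0) (# 1)
    (unreachable ((# 2 , # 1) , # 1) ((# 0 , # 1) , # 0))
    (unreachable ((# 1 , # 1) , # 0) ((# 2 , # 0) , # 0))))
    (unreachable ((# 0 , # 1) , # 1) ((# 1 , # 0) , # 0)))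
    (unreachable ((# 0 , # 0) , # 0) ((# 1 , # 1) , # 0))))
    (unreachable ((# 0 , # 1) , # 0) ((# 1 , # 0) , # 0))))
    (unreachable ((# 0 , # 0) , # 0) ((# 2 , # 0) , # 1)))))
    (unreachable ((# 0 , # 0) , # 1) ((# 2 , # 0) , # 0))))
    (unreachable ((# 0 , # 0) , # 0) ((# 2 , # 0) , # 0)))
    (unreachable ((# 0 , # 0) , # 0) ((# 2 , # 0) , # 0)))

  no-short-orientation : ¬ ShortOrientation
  no-short-orientation (ρ , diam) = refutes-sound certificate (λ _ _ _ → nothing) tt diam

theorem1p8 :
  InC 1 (Path 3 □ Path 2) (λ _ → 2) ×
  ((l m : ℕ) → 2 ≤ m → m ≤ l →
    (s : V (Path l □ Path m) → ℕ) → ((i : V (Path l □ Path m)) → 2 ≤ s i) →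
    (((4 ≤ l × m ≡ 2) ⊎ 3 ≤ m) → InC 0 (Path l □ Path m) s) ×
    ((l ≡ 3 × m ≡ 2) → InC 0 (Path l □ Path m) s ⊎ InC 1 (Path l □ Path m) s))
theorem1p8 =
  Orientations₃₂.¬short⇒inC1 (λ _ → 2) (λ _ → ≤-refl) Refutation₃₂.no-short-orientation ,
  λ l m _ m≤l s hs → in𝒞₀ m≤l s hs , in𝒞₀∪𝒞₁ s hs
  where
    in𝒞₀ : ∀ {l m} → m ≤ l → (s : V (Grid l m) → ℕ) → ((x : V (Grid l m)) → 2 ≤ s x) →
           (4 ≤ l × m ≡ 2) ⊎ 3 ≤ m → InC 0 (Grid l m) s
    in𝒞₀ _   s hs (inj₁ (4≤l , refl)) = ladder-inC0 4≤l s hs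
    in𝒞₀ m≤l s hs (inj₂ 3≤m)         = grid-inC0 3≤m m≤l s hs

    in𝒞₀∪𝒞₁ : ∀ {l m} (s : V (Grid l m) → ℕ) → ((x : V (Grid l m)) → 2 ≤ s x) →
              l ≡ 3 × m ≡ 2 → InC 0 (Grid l m) s ⊎ InC 1 (Grid l m) s
    in𝒞₀∪𝒞₁ s hs (refl , refl) = Orientations₃₂.inC0⊎inC1 s hs
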